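{- Fix $r\ge 2$, $r'\ge 2$ and $k\ge 3$. Suppose that every function $f:2^{[r']}\to[k]$ with the property that, for every partition $A_1,\dots,A_r$ of $[r']$ into $r$ parts, the sequence $f(A_1),\dots,f(A_r)$ has a unique maximum, also has the property that $f(\{1\}),\dots,f(\{r'\})$ has a unique maximum. Then $\mathcal M_{2,k}^r\to\mathcal M_{2,k}^{r'}$.
   Context: A partition of $[n]=\{1,\dots,n\}$ into $p$ parts is a sequence $(A_1,\dots,A_p)$ of pairwise disjoint, possibly empty subsets whose union is $[n]$. $\mathbf{LO}_k^r$ is the $r$-ary structure with domain $[k]$ and relation consisting of all tuples in $[k]^r$ with a unique maximum. For $r$-ary structures $\mathbf{A},\mathbf{B}$, a $p$-ary polymorphism is a function $f: A^p\to B$ such that whenever an $r\times p$ matrix has every column in the relation of $\mathbf A$, applying $f$ to each row yields a tuple in the relation of $\mathbf B$. $\mathrm{Pol}(\mathbf A,\mathbf B)$ is the minion of all polymorphisms with minors $f_\pi(x_1,\dots,x_q)=f(x_{\pi(1)},\dots,x_{\pi(p)})$ for $\pi:[p]\to[q]$. $\mathcal{M}_{2,k}^r = \mathrm{Pol}(\mathbf{LO}_2^r,\mathbf{LO}_k^r)$. A minion homomorphism $\xi:\mathcal M\to\mathcal N$ maps $p$-ary elements to $p$-ary elements with $\xi(f)_\pi=\xi(f_\pi)$; $\mathcal M\to\mathcal N$ means one exists. -}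

module Defs where

open import Data.Nat using (ℕ)
open import Data.Fin using (Fin; _<_)
open import Data.Fin.Subset using (Subset; _∈_; ⁅_⁆)
open import Data.Product using (Σ; ∃; ∃-syntax; _×_; _,_; proj₁; proj₂)
open import Relation.Nullary using (¬_)
open import Relation.Binary.PropositionalEquality using (_≡_; _≢_)
open import Data.Empty using (⊥)
open import Function using (_∘_)

UniqueMax : ∀ {r k} → (Fin r → Fin k) → Set
UniqueMax {r} t = ∃[ i ] (∀ (j : Fin r) → j ≢ i → t j < t i)

LO : (k r : ℕ) → (Fin r → Fin k) → Set
LO k r t = UniqueMax t

-- p-ary polymorphisms LO_2^r → LO_k^r.  A matrix is M : Fin r → Fin p → Fin 2
-- (M i = i-th row); column j is λ i → M i j.
IsPol : (r k p : ℕ) → ((Fin p → Fin 2) → Fin k) → Set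
IsPol r k p f =
  ∀ (M : Fin r → Fin p → Fin 2) →
  (∀ (j : Fin p) → LO 2 r (λ i → M i j)) →
  LO k r (λ i → f (M i))

M2k : (r k p : ℕ) → Set
M2k r k p = Σ ((Fin p → Fin 2) → Fin k) (IsPol r k p)

minor : ∀ {r k p q} → (Fin p → Fin q) → M2k r k p → M2k r k q
minor π (f , pf) = (λ x → f (x ∘ π)) , (λ M cols → pf (λ i → M i ∘ π) (λ j → cols (π j)))

record MinionHom (r r' k : ℕ) : Set where
  field
    ξ : ∀ p → M2k r k p → M2k r' k p
    commutes : ∀ p q (π : Fin p → Fin q) (f : M2k r k p) (x : Fin q → Fin 2) →
      proj₁ (ξ q (minor π f)) x ≡ proj₁ (minor {r'} {k} π (ξ p f)) x

-- (A_1,…,A_r) is a partition of [n] into r (possibly empty) parts.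
IsPartition : ∀ {n} r → (Fin r → Subset n) → Set
IsPartition {n} r A =
  (∀ (i j : Fin r) (x : Fin n) → i ≢ j → x ∈ A i → x ∈ A j → ⊥) ×
  (∀ (x : Fin n) → ∃[ i ] (x ∈ A i))

{-# OPTIONS --safe #-}
module Submission where

-- The identity map on functions is the homomorphism: every
-- polymorphism f of (LO₂ʳ, LOₖʳ) is one of (LO₂ʳ', LOₖʳ'). A matrix with r'
-- rows whose columns lie in LO₂ʳ' has exactly one 1 per column, say in row
-- c j of column j. Put g(S) := f(j ↦ [c j ∈ S]). Then g({x}) = f(row x), and
-- for a partition (A₁,…,A_r) of [r'] the rows j ↦ [c j ∈ Aᵢ] form a matrix
-- whose j-th column is the indicator of the unique part containing c j, so
-- g(A₁),…,g(A_r) has a unique maximum because f is a polymorphism. The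
-- hypothesis applied to g gives the unique maximum of f(row 1),…,f(row r').

open import Defs
open import Data.Nat using (ℕ; _≤_; z≤n; s≤s)
import Data.Nat as ℕ
open import Data.Fin using (Fin; zero; suc; _<_)
open import Data.Fin.Subset using (Subset; ⁅_⁆; _∈_)
open import Data.Fin.Subset.Properties using (_∈?_; x∈⁅x⁆; x∈⁅y⁆⇒x≡y; x∉⁅y⁆⇒x≢y)
open import Data.Fin.Properties using (any?)
open import Data.Vec.Properties using (≡-dec)
open import Data.Bool.Properties using () renaming (_≟_ to _≟ᵇ_)
open import Data.Product using (∃; _×_; _,_; proj₁; proj₂)
open import Relation.Nullary using (Dec; yes; no)
open import Relation.Binary.PropositionalEquality
  using (_≡_; _≢_; refl; sym; cong; subst; subst₂)
open import Data.Empty using (⊥-elim)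

UniqueMax-resp : ∀ {r k} {t u : Fin r → Fin k} →
  (∀ i → t i ≡ u i) → UniqueMax t → UniqueMax u
UniqueMax-resp t≗u (i , max) = i , λ j j≢i → subst₂ _<_ (t≗u j) (t≗u i) (max j j≢i)

<-Fin2 : ∀ {a b : Fin 2} → a < b → (a ≡ zero) × (b ≡ suc zero)
<-Fin2 {zero}     {suc zero} _ = refl , refl
<-Fin2 {suc zero} {suc zero} (s≤s ())

indicator : ∀ {a} {P : Set a} → Dec P → Fin 2
indicator (yes _) = suc zero
indicator (no _)  = zero

module _ {n} {t : Fin (ℕ.suc (ℕ.suc n)) → Fin 2} where

  UniqueMax-Fin2-top : ((c , _) : UniqueMax t) → t c ≡ suc zero
  UniqueMax-Fin2-top (zero  , max) = proj₂ (<-Fin2 (max (suc zero) λ ()))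
  UniqueMax-Fin2-top (suc _ , max) = proj₂ (<-Fin2 (max zero λ ()))

  UniqueMax-Fin2-bot : ((c , _) : UniqueMax t) → ∀ i → i ≢ c → t i ≡ zero
  UniqueMax-Fin2-bot (_ , max) i i≢c = proj₁ (<-Fin2 (max i i≢c))

UniqueMax-partition-indicator : ∀ {n r} {A : Fin r → Subset n} →
  IsPartition r A → ∀ x → UniqueMax (λ i → indicator (x ∈? A i))
UniqueMax-partition-indicator {A = A} (disjoint , covering) x =
  i₀ , λ i i≢i₀ → indicator-< i≢i₀ (x ∈? A i) (x ∈? A i₀)
  where
  i₀ = proj₁ (covering x)
  indicator-< : ∀ {i} → i ≢ i₀ → (d : Dec (x ∈ A i)) (d₀ : Dec (x ∈ A i₀)) →
    indicator d < indicator d₀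
  indicator-< i≢i₀ (yes x∈Aᵢ) _         = ⊥-elim (disjoint _ _ x i≢i₀ x∈Aᵢ (proj₂ (covering x)))
  indicator-< i≢i₀ (no _)     (yes _)   = s≤s z≤n
  indicator-< i≢i₀ (no _)     (no x∉A₀) = ⊥-elim (x∉A₀ (proj₂ (covering x)))

IsSingleton : ∀ {n} → Subset n → Set
IsSingleton S = ∃ λ x → S ≡ ⁅ x ⁆

IsSingleton? : ∀ {n} (S : Subset n) → Dec (IsSingleton S)
IsSingleton? S = any? λ x → ≡-dec _≟ᵇ_ S ⁅ x ⁆

-- On singletons, g returns f (M x) on the nose: without function
-- extensionality, f applied to the pointwise equal row j ↦ [c j ∈ {x}]
-- could not be identified with f (M x).
module SetFunction {n p k} (f : (Fin p → Fin 2) → Fin k)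
  (M : Fin (ℕ.suc (ℕ.suc n)) → Fin p → Fin 2)
  (columns : ∀ j → UniqueMax (λ i → M i j)) where

  argmax : Fin p → Fin (ℕ.suc (ℕ.suc n))
  argmax j = proj₁ (columns j)

  row : (S : Subset (ℕ.suc (ℕ.suc n))) → Dec (IsSingleton S) → Fin p → Fin 2
  row S (yes (x , _)) = M x
  row S (no _)      j = indicator (argmax j ∈? S)

  g : Subset (ℕ.suc (ℕ.suc n)) → Fin k
  g S = f (row S (IsSingleton? S))

  row-indicator : ∀ S d j → row S d j ≡ indicator (argmax j ∈? S)
  row-indicator S (no _) j = refl
  row-indicator S (yes (x , refl)) j with argmax j ∈? ⁅ x ⁆
  ... | yes c∈x = subst (λ i → M i j ≡ suc zero) (x∈⁅y⁆⇒x≡y x c∈x) (UniqueMax-Fin2-top (columns j))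
  ... | no  c∉x = UniqueMax-Fin2-bot (columns j) x (λ x≡c → x∉⁅y⁆⇒x≢y c∉x (sym x≡c))

  g-singleton : ∀ x → g ⁅ x ⁆ ≡ f (M x)
  g-singleton x with IsSingleton? ⁅ x ⁆
  ... | yes (y , ⁅x⁆≡⁅y⁆) = cong (λ i → f (M i)) (sym (x∈⁅y⁆⇒x≡y y (subst (x ∈_) ⁅x⁆≡⁅y⁆ (x∈⁅x⁆ x))))
  ... | no  ¬singleton    = ⊥-elim (¬singleton (x , refl))

  UniqueMax-g-partition : ∀ {r} → IsPol r k p f →
    ∀ (A : Fin r → Subset (ℕ.suc (ℕ.suc n))) → IsPartition r A → UniqueMax (λ i → g (A i))
  UniqueMax-g-partition pol A partition = pol (λ i → row (A i) (IsSingleton? (A i))) λ j →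
    UniqueMax-resp (λ i → sym (row-indicator (A i) (IsSingleton? (A i)) j))
      (UniqueMax-partition-indicator partition (argmax j))

IsPol-inclusion⇒MinionHom : ∀ {r r' k} →
  (∀ p f → IsPol r k p f → IsPol r' k p f) → MinionHom r r' k
IsPol-inclusion⇒MinionHom incl = record
  { ξ        = λ p (f , pol) → f , incl p f pol
  ; commutes = λ _ _ _ _ _ → refl
  }

corollary5p11 : (r r' k : ℕ) → 2 ≤ r → 2 ≤ r' → 3 ≤ k →
    (∀ (f : Subset r' → Fin k) →
    (∀ (A : Fin r → Subset r') → IsPartition r A → UniqueMax (λ i → f (A i))) →
    UniqueMax (λ (x : Fin r') → f ⁅ x ⁆)) →
    MinionHom r r' k
corollary5p11 r (ℕ.suc (ℕ.suc n)) k _ (s≤s (s≤s _)) _ hyp =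
  IsPol-inclusion⇒MinionHom λ p f pol M columns →
    let open SetFunction f M columns in
    UniqueMax-resp g-singleton (hyp g (UniqueMax-g-partition pol))
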